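{- Let $M$ be a one-counter machine. A configuration $(i,c)$ terminates in $M$ if and only if there is $k\in\mathbb{N}$ such that for all configurations $(i',c')$ with $(i,c)\longrightarrow_{M}^{*}(i',c')$ we have $c'<k$.
   Context: A one-counter machine $M$ is a finite list of instructions, each of shape $(j,d)$ with $j\in\mathbb{N}$ and $d\in\{1,2,3,4\}$; instructions are indexed from $0$, and $|M|$ is the length of the list. A configuration is a pair $(i,c)$ with $i\in\mathbb{N}$ and $c\in\mathbb{N}$, $c>0$. Step relation $\longrightarrow_{M}$: if $|M|\le i$ then $(i,c)\longrightarrow_{M}(i,c)$ and $(i,c)$ is called halting; if the instruction at index $i$ is $(j,d)$ and $d\mid c$ then $(i,c)\longrightarrow_{M}(j,c\cdot\frac{d+1}{d})$; if the instruction at index $i$ is $(j,d)$ and $d\nmid c$ then $(i,c)\longrightarrow_{M}(i+1,c)$. $\longrightarrow_{M}^{*}$ is the reflexive transitive closure of $\longrightarrow_{M}$. A configuration $(i,c)$ terminates in $M$ if $(i,c)\longrightarrow_{M}^{*}(i',c')$ for some halting configuration $(i',c')$. -}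

module Defs where

open import Data.Nat using (ℕ; zero; suc; _*_; _+_; _<_; _≤_; NonZero)
open import Data.Nat.Divisibility using (_∣_; _∤_)
open import Data.Nat.DivMod using (_/_)
open import Data.List using (List; length; lookup)
open import Data.Fin using (Fin; fromℕ<)
open import Data.Product using (_×_; _,_; ∃)
open import Relation.Nullary using (¬_)
open import Relation.Binary.PropositionalEquality using (_≡_)
open import Relation.Binary.Construct.Closure.ReflexiveTransitive using (Star)

data Div : Set where
  d1 d2 d3 d4 : Div

val : Div → ℕ
val d1 = 1
val d2 = 2
val d3 = 3
val d4 = 4

Instr : Set
Instr = ℕ × Div

-- A one-counter machine: a finite list of instructions, indexed from 0.
Machine : Set
Machine = List Instr

-- A configuration (i , c); positivity of c is imposed where needed (c > 0).
Config : Set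
Config = ℕ × ℕ

-- c * (d+1) / d  (exact when d ∣ c)
bump : Div → ℕ → ℕ
bump d1 c = (c * 2) / 1
bump d2 c = (c * 3) / 2
bump d3 c = (c * 4) / 3
bump d4 c = (c * 5) / 4

data Step (M : Machine) : Config → Config → Set where
  halt : ∀ {i c} → length M ≤ i → Step M (i , c) (i , c)
  jump : ∀ {i c j d} (i< : i < length M) →
         lookup M (fromℕ< i<) ≡ (j , d) → val d ∣ c →
         Step M (i , c) (j , bump d c)
  next : ∀ {i c j d} (i< : i < length M) →
         lookup M (fromℕ< i<) ≡ (j , d) → val d ∤ c →
         Step M (i , c) (suc i , c)

_⟶*[_]_ : Config → Machine → Config → Set
x ⟶*[ M ] y = Star (Step M) x y

Halting : Machine → Config → Set
Halting M (i , c) = length M ≤ i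

Terminates : Machine → Config → Set
Terminates M x = ∃ λ y → x ⟶*[ M ] y × Halting M y

module Submission where

-- A terminating run is, by determinism, the only run: every reachable configuration lies
-- on it or is its (idling) halting end, so the counter is bounded by the run's maximum.
-- Conversely, while the machine is running a step either jumps, strictly increasing the
-- counter, or falls through to the next instruction.  If the counter stays below k, the
-- measure (k ∸ c) · (|M| + 1) + (|M| ∸ i) therefore strictly decreases at every step
-- until a halting configuration is reached.

open import Defs
open import Data.Nat using (ℕ; suc; _+_; _*_; _∸_; _⊔_; _≤_; _<_; NonZero; >-nonZero; s≤s)
open import Data.Nat.Properties
open import Data.Nat.Divisibility using (_∣_; divides; _∣?_)
open import Data.Nat.DivMod using (_/_; m*n/n≡m)
open import Data.Nat.Induction using (<-wellFounded)
open import Data.List using (length; lookup)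
open import Data.Fin using (fromℕ<)
open import Data.Product using (_,_; ∃; proj₂)
open import Relation.Nullary using (yes; no; contradiction)
open import Relation.Binary.PropositionalEquality using (_≡_; refl; sym; trans; cong; subst)
open import Relation.Binary.Construct.Closure.ReflexiveTransitive using (ε; _◅_)
open import Relation.Binary.Construct.On as On using ()
open import Induction.WellFounded using (Acc; acc)
open import Function.Base using (_on_)
open import Function.Bundles using (_⇔_; mk⇔)

counter : Config → ℕ
counter = proj₂

m*n*[1+n]/n≡m*[1+n] : ∀ m n .{{_ : NonZero n}} → m * n * suc n / n ≡ m * suc n
m*n*[1+n]/n≡m*[1+n] m n = trans (cong (_/ n) reassociate) (m*n/n≡m (m * suc n) n)
  where
  reassociate : m * n * suc n ≡ m * suc n * n
  reassociate = trans (*-assoc m n (suc n))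
                  (trans (cong (m *_) (*-comm n (suc n))) (sym (*-assoc m (suc n) n)))

bump-multiple : ∀ d q → bump d (q * val d) ≡ q * suc (val d)
bump-multiple d1 q = m*n*[1+n]/n≡m*[1+n] q 1
bump-multiple d2 q = m*n*[1+n]/n≡m*[1+n] q 2
bump-multiple d3 q = m*n*[1+n]/n≡m*[1+n] q 3
bump-multiple d4 q = m*n*[1+n]/n≡m*[1+n] q 4

<-bump : ∀ d {c} → 0 < c → val d ∣ c → c < bump d c
<-bump d {c} 0<c (divides q refl) = subst (c <_) (sym (bump-multiple d q)) c<q*[1+d]
  where
  instance
    q≢0 : NonZero q
    q≢0 = m*n≢0⇒m≢0 q {{>-nonZero 0<c}}
  c<q*[1+d] : q * val d < q * suc (val d)
  c<q*[1+d] = *-monoʳ-< q (n<1+n (val d))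

Step-running : ∀ {M i} c → i < length M → ∃ (Step M (i , c))
Step-running {M} {i} c i< with lookup M (fromℕ< i<) in instr
... | j , d with val d ∣? c
...   | yes d∣c = _ , jump i< instr d∣c
...   | no d∤c = _ , next i< instr d∤c

same-instruction : ∀ M {i j j′ d d′} (i< i<′ : i < length M) →
                   lookup M (fromℕ< i<) ≡ (j , d) → lookup M (fromℕ< i<′) ≡ (j′ , d′) →
                   _≡_ {A = Instr} (j , d) (j′ , d′)
same-instruction M i< i<′ e e′ =
  trans (sym e) (trans (cong (λ p → lookup M (fromℕ< p)) (≤-irrelevant i< i<′)) e′)

Step-deterministic : ∀ {M x y z} → Step M x y → Step M x z → y ≡ z
Step-deterministic (halt _) (halt _) = refl
Step-deterministic (halt h) (jump i< _ _) = contradiction h (<⇒≱ i<)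
Step-deterministic (halt h) (next i< _ _) = contradiction h (<⇒≱ i<)
Step-deterministic (jump i< _ _) (halt h) = contradiction h (<⇒≱ i<)
Step-deterministic (next i< _ _) (halt h) = contradiction h (<⇒≱ i<)
Step-deterministic {M} (jump i< e _) (jump i<′ e′ _) with same-instruction M i< i<′ e e′
... | refl = refl
Step-deterministic {M} (jump i< e d∣c) (next i<′ e′ d∤c) with same-instruction M i< i<′ e e′
... | refl = contradiction d∣c d∤c
Step-deterministic {M} (next i< e d∤c) (jump i<′ e′ d∣c) with same-instruction M i< i<′ e e′
... | refl = contradiction d∣c d∤c
Step-deterministic (next _ _ _) (next _ _ _) = refl

counter-nondecreasing : ∀ {M x y} → 0 < counter x → Step M x y → counter x ≤ counter y
counter-nondecreasing _ (halt _) = ≤-refl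
counter-nondecreasing 0<c (jump {d = d} _ _ d∣c) = <⇒≤ (<-bump d 0<c d∣c)
counter-nondecreasing _ (next _ _ _) = ≤-refl

maxCounter : ∀ {M x y} → x ⟶*[ M ] y → ℕ
maxCounter {x = x} ε = counter x
maxCounter {x = x} (_ ◅ run) = counter x ⊔ maxCounter run

counter≤maxCounter : ∀ {M x y} (run : x ⟶*[ M ] y) → counter x ≤ maxCounter run
counter≤maxCounter ε = ≤-refl
counter≤maxCounter {x = x} (_ ◅ run) = m≤m⊔n (counter x) (maxCounter run)

reachable-counter≤maxCounter : ∀ {M x y z} (run : x ⟶*[ M ] y) → Halting M y →
                               x ⟶*[ M ] z → counter z ≤ maxCounter run
reachable-counter≤maxCounter run _ ε = counter≤maxCounter run
reachable-counter≤maxCounter ε halts (s ◅ other) with Step-deterministic s (halt halts)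
... | refl = reachable-counter≤maxCounter ε halts other
reachable-counter≤maxCounter {x = x} (s ◅ run) halts (s′ ◅ other) with Step-deterministic s s′
... | refl = ≤-trans (reachable-counter≤maxCounter run halts other)
                     (m≤n⊔m (counter x) (maxCounter run))

CounterBoundedFrom : Machine → ℕ → Config → Set
CounterBoundedFrom M k x = ∀ i′ c′ → x ⟶*[ M ] (i′ , c′) → c′ < k

terminates⇒counterBounded : ∀ {M x} → Terminates M x → ∃ λ k → CounterBoundedFrom M k x
terminates⇒counterBounded (_ , run , halts) =
  suc (maxCounter run) , λ _ _ other → s≤s (reachable-counter≤maxCounter run halts other)

+-*-lex-< : ∀ {a a′ b b′} n → b ≤ n → a < a′ → a * suc n + b < a′ * suc n + b′
+-*-lex-< {a} {a′} {b} {b′} n b≤n a<a′ = begin-strict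
  a * suc n + b    ≤⟨ +-monoʳ-≤ (a * suc n) b≤n ⟩
  a * suc n + n    <⟨ +-monoʳ-< (a * suc n) (n<1+n n) ⟩
  a * suc n + suc n ≡⟨ +-comm (a * suc n) (suc n) ⟩
  suc a * suc n    ≤⟨ *-monoˡ-≤ (suc n) a<a′ ⟩
  a′ * suc n       ≤⟨ m≤m+n (a′ * suc n) b′ ⟩
  a′ * suc n + b′  ∎
  where open ≤-Reasoning

module _ (M : Machine) (k : ℕ) where

  measure : Config → ℕ
  measure (i , c) = (k ∸ c) * suc (length M) + (length M ∸ i)

  measure-decreasing : ∀ {i c y} → 0 < c → i < length M → Step M (i , c) y →
                       counter y < k → measure y < measure (i , c)
  measure-decreasing _ i< (halt h) _ = contradiction h (<⇒≱ i<)
  measure-decreasing {c = c} 0<c _ (jump {j = j} {d = d} _ _ d∣c) c′<k =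
    +-*-lex-< (length M) (m∸n≤m (length M) j)
      (∸-monoʳ-< (<-bump d 0<c d∣c) (<⇒≤ c′<k))
  measure-decreasing {i} {c} _ i< (next _ _ _) _ =
    +-monoʳ-< ((k ∸ c) * suc (length M)) (∸-monoʳ-< (n<1+n i) i<)

  counterBounded⇒terminates′ : ∀ {x} → Acc (_<_ on measure) x → 0 < counter x →
                               CounterBoundedFrom M k x → Terminates M x
  counterBounded⇒terminates′ {i , c} (acc smaller) 0<c bounded with i <? length M
  ... | no i≮∣M∣ = (i , c) , ε , ≮⇒≥ i≮∣M∣
  ... | yes i< with Step-running c i<
  ...   | (i′ , c′) , s with counterBounded⇒terminates′
            (smaller (measure-decreasing 0<c i< s (bounded i′ c′ (s ◅ ε))))
            (<-≤-trans 0<c (counter-nondecreasing 0<c s))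
            (λ i″ c″ run → bounded i″ c″ (s ◅ run))
  ...     | z , run , halts = z , s ◅ run , halts

  counterBounded⇒terminates : ∀ {x} → 0 < counter x → CounterBoundedFrom M k x → Terminates M x
  counterBounded⇒terminates {x} =
    counterBounded⇒terminates′ (On.wellFounded measure <-wellFounded x)

lemma3p5 : (M : Machine) (i c : ℕ) → 0 < c →
    (Terminates M (i , c) ⇔ ∃ λ k → ∀ i′ c′ → (i , c) ⟶*[ M ] (i′ , c′) → c′ < k)
lemma3p5 M i c 0<c = mk⇔ terminates⇒counterBounded
  (λ (k , bounded) → counterBounded⇒terminates M k 0<c bounded)
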